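{- Let $\mathcal{G}$ be a simple temporal clique, and let $E^+_T$ and the collectors be as defined below. For every vertex $v$ that is not a collector, there exist a vertex $v'\neq v$ lying in the same weakly connected component of the digraph $(V,E^+_T)$ as $v$ (which may or may not be a collector) and a journey from $v'$ to $v$ consisting of at most two edges whose first edge is $e^+(v')$.
   Context: A simple temporal clique is a pair $\mathcal{G}=(G,\lambda)$ where $G=(V,E)$ is the complete graph on a finite vertex set $V$ with $|V|\ge 2$, and $\lambda:E\to\mathbb{N}$ assigns each edge a single label such that any two distinct edges sharing an endpoint have distinct labels. A journey is a sequence of edges $\{u_1,u_2\},\dots,\{u_k,u_{k+1}\}$ ($k\ge1$) with the $u_i$ pairwise distinct and strictly increasing labels. For a vertex $v$, $e^+(v)$ denotes the edge incident to $v$ with the largest label. Let $E^+$ be the set of arcs on $V$ containing, for each vertex $v$ with $e^+(v)=\{u,v\}$, the arc $(v,u)$, except that whenever $e^+(u)=e^+(v)$ only one of $(u,v),(v,u)$ is included (chosen arbitrarily). A source of $E^+$ is a vertex of in-degree $0$ in $(V,E^+)$. $E^+_T$ is obtained from $E^+$ as follows: for every vertex $v$ of in-degree at least $2$ in $E^+$, let $(u_1,v),\dots,(u_\ell,v)$ be its in-arcs where $(u_\ell,v)$ has the smallest label; for each $i<\ell$, if $u_i$ is a source of $E^+$ replace $(u_i,v)$ by $(v,u_i)$, otherwise delete $(u_i,v)$. The collectors are the vertices of in-degree $0$ in $(V,E^+_T)$; the weakly connected components of $(V,E^+_T)$ are called out-trees. -}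

module Defs where

open import Data.Nat using (ℕ; _<_)
open import Data.Fin using (Fin)
open import Data.List using (List; []; _∷_)
open import Data.List.Relation.Unary.Linked using (Linked)
open import Data.List.Relation.Unary.Unique.Propositional using (Unique)
open import Data.Product using (_×_)
open import Data.Sum using (_⊎_)
open import Data.Empty using (⊥)
open import Relation.Nullary using (¬_)
open import Relation.Binary.PropositionalEquality using (_≡_; _≢_)
open import Relation.Binary.Construct.Closure.Symmetric using (SymClosure)
open import Relation.Binary.Construct.Closure.ReflexiveTransitive using (Star)

-- A labelling of the complete graph on Fin n: lab u v is the label of the
-- edge {u,v} (the diagonal values lab v v are irrelevant and never used).
Labelling : ℕ → Set
Labelling n = Fin n → Fin n → ℕ

record IsSimpleTemporalClique {n : ℕ} (lab : Labelling n) : Set where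
  field
    symm   : ∀ u v → u ≢ v → lab u v ≡ lab v u
    proper : ∀ u v w → u ≢ v → u ≢ w → v ≢ w → lab u v ≢ lab u w

IsTop : {n : ℕ} → Labelling n → Fin n → Fin n → Set
IsTop lab v u = (u ≢ v) × (∀ w → w ≢ v → w ≢ u → lab v w < lab v u)

edgeLabels : {n : ℕ} → Labelling n → List (Fin n) → List ℕ
edgeLabels lab (x ∷ y ∷ r) = lab x y ∷ edgeLabels lab (y ∷ r)
edgeLabels lab _ = []

data AtLeastTwo {A : Set} : List A → Set where
  two : ∀ x y r → AtLeastTwo (x ∷ y ∷ r)

Journey : {n : ℕ} → Labelling n → List (Fin n) → Set
Journey lab xs = AtLeastTwo xs × Unique xs × Linked _<_ (edgeLabels lab xs)

FirstEdgeIsTop : {n : ℕ} → (Fin n → Fin n) → List (Fin n) → Set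
FirstEdgeIsTop t (x ∷ y ∷ _) = y ≡ t x
FirstEdgeIsTop t _ = ⊥

-- A is a valid choice of E⁺ for the function t = (v ↦ other endpoint of e⁺(v)):
-- every arc is (v, t v); (v, t v) is present whenever e⁺(t v) ≠ e⁺(v);
-- and when e⁺(t v) = e⁺(v) exactly one of the two orientations is present.
record IsEplus {n : ℕ} (t : Fin n → Fin n) (A : Fin n → Fin n → Set) : Set where
  field
    arc-top : ∀ x y → A x y → y ≡ t x
    nonmutual : ∀ x → t (t x) ≢ x → A x (t x)
    mutual-one : ∀ x → t (t x) ≡ x → A x (t x) ⊎ A (t x) x
    mutual-notboth : ∀ x → t (t x) ≡ x → ¬ (A x (t x) × A (t x) x)

Source : {n : ℕ} → (Fin n → Fin n → Set) → Fin n → Set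
Source A y = ∀ w → ¬ A w y

MinIn : {n : ℕ} → Labelling n → (Fin n → Fin n → Set) → Fin n → Fin n → Set
MinIn lab A x y = A x y × (∀ w → A w y → w ≢ x → lab x y < lab w y)

-- E⁺_T: arcs of E⁺ into in-degree-1 vertices and smallest-label in-arcs are
-- kept; every other in-arc (u,v) of a vertex of in-degree ≥ 2 is reversed to
-- (v,u) if u is a source of E⁺ and deleted otherwise.
ET : {n : ℕ} → Labelling n → (Fin n → Fin n → Set) → Fin n → Fin n → Set
ET lab A x y = MinIn lab A x y ⊎ (A y x × ¬ MinIn lab A y x × Source A y)

Collector : {n : ℕ} → Labelling n → (Fin n → Fin n → Set) → Fin n → Set
Collector lab A v = ∀ w → ¬ ET lab A w v

SameOutTree : {n : ℕ} → Labelling n → (Fin n → Fin n → Set) → Fin n → Fin n → Set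
SameOutTree lab A = Star (SymClosure (ET lab A))

module Submission where

-- If v has an in-arc in E⁺, its smallest-label in-arc (u, v) survives in E⁺_T and
-- is e⁺(u), a one-edge journey. Otherwise v is a source of E⁺; not being a
-- collector, its arc (v, t v) must have been reversed, so t v has a smaller-label
-- in-arc (u, t v) = e⁺(u), and u → t v → v is a journey inside the out-tree.

open import Defs
open import Data.Nat using (ℕ; _≤_; _<_; z≤n; s≤s)
open import Data.Nat.Properties using (≤∧≢⇒<; <-asym)
open import Data.Fin using (Fin; _≟_)
open import Data.Fin.Properties using (any?)
open import Data.List using (List; []; _∷_; _++_; length; allFin; filter)
open import Data.List.Extrema.Nat using (argmin; argmin-all; f[argmin]≤f[xs])
open import Data.List.Membership.Propositional.Properties using (∈-allFin; ∈-filter⁺)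
open import Data.List.Relation.Unary.All using (lookup; []; _∷_)
open import Data.List.Relation.Unary.All.Properties using (all-filter)
open import Data.List.Relation.Unary.AllPairs using ([]; _∷_)
open import Data.List.Relation.Unary.Linked using ([-]; _∷_)
open import Data.Product using (_×_; ∃-syntax; _,_; proj₁; proj₂)
open import Data.Sum using (_⊎_; inj₁; inj₂)
open import Data.Empty using (⊥-elim)
open import Relation.Nullary using (¬_; Dec; yes; no)
open import Relation.Unary using (Pred; Decidable)
open import Relation.Binary.PropositionalEquality using (_≡_; _≢_; refl; sym; trans; subst)
open import Relation.Binary.Construct.Closure.Symmetric using (fwd)
open import Relation.Binary.Construct.Closure.ReflexiveTransitive using (ε; _◅_)

module _ {n : ℕ} {p} {P : Pred (Fin n) p} (P? : Decidable P) (f : Fin n → ℕ) where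

  ∃-minimal : ∀ {w} → P w → ∃[ m ] (P m × ∀ x → P x → f m ≤ f x)
  ∃-minimal {w} pw = m , argmin-all f pw (all-filter P? (allFin n)) , minimal
    where
    candidates : List (Fin n)
    candidates = filter P? (allFin n)

    m : Fin n
    m = argmin f w candidates

    minimal : ∀ x → P x → f m ≤ f x
    minimal x px = lookup (f[argmin]≤f[xs] w candidates) (∈-filter⁺ P? (∈-allFin x) px)

module _ {n : ℕ} (lab : Labelling n) where

  journey₁ : ∀ {u w} → u ≢ w → Journey lab (u ∷ w ∷ [])
  journey₁ {u} {w} u≢w = two u w [] , (u≢w ∷ []) ∷ [] ∷ [] , [-]

  journey₂ : ∀ {u w v} → u ≢ w → u ≢ v → w ≢ v → lab u w < lab w v →
             Journey lab (u ∷ w ∷ v ∷ [])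
  journey₂ {u} {w} {v} u≢w u≢v w≢v increasing =
    two u w (v ∷ []) , (u≢w ∷ u≢v ∷ []) ∷ (w≢v ∷ []) ∷ [] ∷ [] , increasing ∷ [-]

module _ {n : ℕ} {lab : Labelling n} (clique : IsSimpleTemporalClique lab)
         {t : Fin n → Fin n} (tops : ∀ v → IsTop lab v (t v))
         {A : Fin n → Fin n → Set} (eplus : IsEplus t A) where

  open IsSimpleTemporalClique clique
  open IsEplus eplus

  t-irrefl : ∀ x → t x ≢ x
  t-irrefl x = proj₁ (tops x)

  t-irreflʳ : ∀ x → x ≢ t x
  t-irreflʳ x x≡tx = t-irrefl x (sym x≡tx)

  A? : ∀ x y → Dec (A x y)
  A? x y with y ≟ t x
  ... | no y≢tx = no (λ a → y≢tx (arc-top x y a))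
  ... | yes refl with t (t x) ≟ x
  ...   | no ttx≢x = yes (nonmutual x ttx≢x)
  ...   | yes ttx≡x with mutual-one x ttx≡x
  ...     | inj₁ a = yes a
  ...     | inj₂ b = no (λ a → mutual-notboth x ttx≡x (a , b))

  in-arc-labels-distinct : ∀ {x w y} → A x y → A w y → w ≢ x → lab x y ≢ lab w y
  in-arc-labels-distinct {x} {w} {y} ax aw w≢x eq
    with refl ← arc-top x y ax | y≡tw ← arc-top w y aw =
    proper y x w (t-irrefl x) y≢w (λ x≡w → w≢x (sym x≡w))
      (trans (symm y x (t-irrefl x)) (trans eq (symm w y (λ w≡y → y≢w (sym w≡y)))))
    where
    y≢w : y ≢ w
    y≢w y≡w = t-irrefl w (trans (sym y≡tw) y≡w)

  ∃-minIn : ∀ {w y} → A w y → ∃[ u ] MinIn lab A u y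
  ∃-minIn {y = y} aw with ∃-minimal (λ x → A? x y) (λ x → lab x y) aw
  ... | u , au , minimal =
    u , au , λ x ax x≢u → ≤∧≢⇒< (minimal x ax) (in-arc-labels-distinct au ax x≢u)

  source-or-minIn : ∀ y → Source A y ⊎ ∃[ u ] MinIn lab A u y
  source-or-minIn y with any? (λ x → A? x y)
  ... | yes (w , aw) = inj₂ (∃-minIn aw)
  ... | no no-in-arc = inj₁ (λ w aw → no-in-arc (w , aw))

  source-collector : ∀ {v} → Source A v → ¬ A v (t v) ⊎ MinIn lab A v (t v) →
                     Collector lab A v
  source-collector src _ w (inj₁ (aw , _)) = src w aw
  source-collector {v} _ top-absent-or-kept w (inj₂ (avw , not-min , _))
    with refl ← arc-top v w avw with top-absent-or-kept
  ... | inj₁ ¬a = ¬a avw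
  ... | inj₂ min = not-min min

  TopJourney : Fin n → Fin n → Set
  TopJourney v' v =
    v' ≢ v × SameOutTree lab A v' v ×
    ∃[ mid ] (length mid ≤ 1 × Journey lab (v' ∷ mid ++ v ∷ []) ×
      FirstEdgeIsTop t (v' ∷ mid ++ v ∷ []))

  minIn-topJourney : ∀ {u v} → MinIn lab A u v → TopJourney u v
  minIn-topJourney {u} min with refl ← arc-top u _ (proj₁ min) =
    t-irreflʳ u , fwd (inj₁ min) ◅ ε , [] , z≤n , journey₁ lab (t-irreflʳ u) , refl

  source-topJourney : ∀ {u v} → Source A v → A v (t v) → MinIn lab A u (t v) → u ≢ v →
                      TopJourney u v
  source-topJourney {u} {v} src a min u≢v =
    u≢v , fwd (inj₁ min) ◅ fwd (inj₂ (a , v-not-min , src)) ◅ ε ,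
    t v ∷ [] , s≤s z≤n ,
    journey₂ lab (λ u≡tv → t-irreflʳ u (trans u≡tv tv≡tu)) u≢v (t-irrefl v)
      (subst (lab u (t v) <_) (symm v (t v) (t-irreflʳ v)) u-below-v) ,
    tv≡tu
    where
    tv≡tu : t v ≡ t u
    tv≡tu = arc-top u (t v) (proj₁ min)

    u-below-v : lab u (t v) < lab v (t v)
    u-below-v = proj₂ min v a (λ v≡u → u≢v (sym v≡u))

    v-not-min : ¬ MinIn lab A v (t v)
    v-not-min (_ , v-min) = <-asym u-below-v (v-min u (proj₁ min) u≢v)

lemma6 : (n : ℕ) → 2 ≤ n → (lab : Labelling n) → IsSimpleTemporalClique lab →
         (t : Fin n → Fin n) → (∀ v → IsTop lab v (t v)) →
         (A : Fin n → Fin n → Set) → IsEplus t A →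
         (v : Fin n) → ¬ Collector lab A v →
         ∃[ v' ] (v' ≢ v × SameOutTree lab A v' v ×
           ∃[ mid ] (length mid ≤ 1 × Journey lab (v' ∷ mid ++ v ∷ []) ×
             FirstEdgeIsTop t (v' ∷ mid ++ v ∷ [])))
lemma6 n _ lab clique t tops A eplus v not-collector with source-or-minIn clique tops eplus v
... | inj₂ (u , min) = u , minIn-topJourney clique tops eplus min
... | inj₁ src with A? clique tops eplus v (t v)
...   | no ¬a = ⊥-elim (not-collector (source-collector clique tops eplus src (inj₁ ¬a)))
...   | yes a with ∃-minIn clique tops eplus a
...     | u , min with u ≟ v
...       | yes refl = ⊥-elim (not-collector (source-collector clique tops eplus src (inj₂ min)))
...       | no u≢v = u , source-topJourney clique tops eplus src a min u≢v
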